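{- If $M$ is a matroid then $T^2_M(1-s,1-t;0,0)=\bar{\chi}_M(s,t)$.
   Context: For a matroid $M$ on ground set $\mathcal{A}$ with rank function $\mathrm{rk}$, $T^2_M(x_1,x_2;y_1,y_2)=\sum_{S_1\subseteq S_2\subseteq\mathcal{A}}\prod_{i=1}^2(x_i-1)^{\mathrm{rk}(\mathcal{A})-\mathrm{rk}(S_i)}(y_i-1)^{|S_i|-\mathrm{rk}(S_i)}$. Let $L(M)$ be the lattice of flats, $\mu$ its Möbius function, and $\mathrm{crk}(X)=\mathrm{rk}(\mathcal{A})-\mathrm{rk}(X)$. The Möbius polynomial is $\bar{\chi}_M(s,t)=\sum_{X\le Y\in L(M)}\mu(X,Y)s^{\mathrm{crk}(X)}t^{\mathrm{crk}(Y)}$. -}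

module Defs where

open import Level using (Level)
open import Data.Bool using (Bool; true; false; _∧_; _∨_; not; if_then_else_)
open import Data.Nat using (ℕ; zero; suc; _∸_; _≤_; _<ᵇ_; _≡ᵇ_)
open import Data.Nat.Properties using ()
open import Data.List using (List; []; _∷_; map; _++_; foldr; filter; concatMap; allFin)
open import Data.Vec using (Vec; []; _∷_)
open import Data.Fin using (Fin)
open import Data.Fin.Subset using (Subset; _∪_; _∩_; _⊆_; ∣_∣; ⁅_⁆; _∈_; _∉_; ⊤)
open import Algebra.Bundles using (CommutativeRing)

-- Matroids on the finite ground set 𝒜 = Fin n, given by a rank function
-- (standard rank axioms R1–R3).

record Matroid (n : ℕ) : Set where
  field
    rk          : Subset n → ℕ
    rk-bounded  : ∀ S → rk S ≤ ∣ S ∣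
    rk-mono     : ∀ {S T} → S ⊆ T → rk S ≤ rk T
    rk-submod   : ∀ S T → rk (S ∪ T) Data.Nat.+ rk (S ∩ T) ≤ rk S Data.Nat.+ rk T

subsets : (n : ℕ) → List (Subset n)
subsets zero    = [] ∷ []
subsets (suc n) = map (false ∷_) (subsets n) ++ map (true ∷_) (subsets n)

memb : ∀ {n} → Fin n → Subset n → Bool
memb Fin.zero    (b ∷ _) = b
memb (Fin.suc i) (_ ∷ s) = memb i s

_⊆ᵇ_ : ∀ {n} → Subset n → Subset n → Bool
[]      ⊆ᵇ []      = true
(a ∷ s) ⊆ᵇ (b ∷ t) = (not a ∨ b) ∧ (s ⊆ᵇ t)

_≡ˢ_ : ∀ {n} → Subset n → Subset n → Bool
[]      ≡ˢ []      = true
(a ∷ s) ≡ˢ (b ∷ t) = ((a ∧ b) ∨ (not a ∧ not b)) ∧ (s ≡ˢ t)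

module _ {c ℓ : Level} (R : CommutativeRing c ℓ) where
  open CommutativeRing R

  sumL : {A : Set} → List A → (A → Carrier) → Carrier
  sumL xs f = foldr (λ a r → f a + r) 0# xs

  pow : Carrier → ℕ → Carrier
  pow x zero    = 1#
  pow x (suc k) = x * pow x k

module MatroidDefs {n : ℕ} (M : Matroid n) where
  open Matroid M

  crk : Subset n → ℕ
  crk X = rk ⊤ ∸ rk X

  nullity : Subset n → ℕ
  nullity S = ∣ S ∣ ∸ rk S

  isFlat : Subset n → Bool
  isFlat X = foldr _∧_ true (map (λ e → memb e X ∨ (rk X <ᵇ rk (X ∪ ⁅ e ⁆))) (allFin n))

  flats : List (Subset n)
  flats = filter (λ X → Data.Bool.T? (isFlat X)) (subsets n)

  module _ {c ℓ : Level} (R : CommutativeRing c ℓ) where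
    open CommutativeRing R

    -- Möbius function of L(M), by the usual recursion
    --   μ(X,X) = 1,  μ(X,Y) = − Σ_{X ≤ Z < Y} μ(X,Z) for X < Y,  μ(X,Y) = 0 otherwise,
    -- computed with fuel (chains in L(M) have length ≤ n, so fuel n+1 suffices).
    μ' : ℕ → Subset n → Subset n → Carrier
    μ' zero    X Y = 0#
    μ' (suc k) X Y =
      if X ≡ˢ Y then 1#
      else if X ⊆ᵇ Y
        then - (sumL R (filter (λ Z → Data.Bool.T? ((X ⊆ᵇ Z) ∧ (Z ⊆ᵇ Y) ∧ not (Z ≡ˢ Y))) flats)
                 (λ Z → μ' k X Z))
        else 0#

    μ : Subset n → Subset n → Carrier
    μ = μ' (suc n)

    mobiusPoly : Carrier → Carrier → Carrier
    mobiusPoly s t =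
      sumL R flats (λ X → sumL R flats (λ Y →
        if X ⊆ᵇ Y then μ X Y * (pow R s (crk X) * pow R t (crk Y)) else 0#))

    T² : Carrier → Carrier → Carrier → Carrier → Carrier
    T² x₁ x₂ y₁ y₂ =
      sumL R (subsets n) (λ S₁ → sumL R (subsets n) (λ S₂ →
        if S₁ ⊆ᵇ S₂
          then (pow R (x₁ - 1#) (crk S₁) * pow R (y₁ - 1#) (nullity S₁))
             * (pow R (x₂ - 1#) (crk S₂) * pow R (y₂ - 1#) (nullity S₂))
          else 0#))

module Submission where

-- At x = 1 - s and y = 0 a pair S₁ ⊆ S₂ contributes s^crk(S₁) t^crk(S₂) (-1)^(|S₁| + |S₂|),
-- because crk S + nullity S ≡ rk 𝒜 + |S| (mod 2). As crk S = crk (cl S), grouping the pairs by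
-- the flats X = cl S₁ ⊆ Y = cl S₂ writes T² as Σ_{X,Y} signedSpans X Y s^crk(X) t^crk(Y), so it
-- remains to show that signedSpans is the Möbius function. Given S₁ ⊆ S₂ and cl S₁ = X, the flat
-- cl S₂ lies in [X, Y] exactly when S₂ ⊆ Y; hence Σ_{X ≤ Z ≤ Y} signedSpans X Z is the alternating
-- sum over S₁ ⊆ S₂ ⊆ Y with cl S₁ = X, which collapses to [X = Y]: the recursion that defines μ.

open import Defs
open import Level using (Level)
open import Function using (_∘_; id)
open import Data.Bool using (Bool; true; false; _∧_; not; if_then_else_; T)
open import Data.Bool.Properties using (∧-identityʳ; ∧-assoc)
open import Data.Empty using (⊥-elim)
open import Data.Nat as ℕ using (ℕ; zero; suc; _∸_; _≤_; _<_; s≤s)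
open import Data.Nat.Properties as ℕ using (<ᵇ-reflects-<)
open import Data.Vec using ([]; _∷_; here; there)
open import Data.Fin using (Fin)
open import Data.Fin.Subset using (Subset; _⊆_; _∈_; ∣_∣; inside; outside; _∪_; _∩_; ⁅_⁆; ⊤)
open import Data.Fin.Subset.Properties using (drop-∷-⊆; drop-there; out⊆; s⊆s; p⊆q⇒∣p∣≤∣q∣; ∣p∣≤n; ⊆⊤; ⊆-antisym; ⊆-refl; p⊆p∪q; q⊆p∪q; x∈p∪q⁻; x∈p∩q⁺; x∈⁅x⁆; x∈⁅y⁆⇒x≡y)
open import Data.Vec.Properties using (∷-injectiveʳ)
open import Data.List using (List; []; _∷_; map; _++_; filter; allFin; foldl)
open import Data.Bool.ListAction using (all)
open import Data.List.Relation.Unary.All as All using (All; []; _∷_)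
open import Data.List.Membership.Propositional.Properties using (∈-allFin; ∈-filter⁻)
open import Data.List.Membership.Propositional using () renaming (_∈_ to _∈ₗ_)
open import Data.List.Relation.Unary.Any using (here; there)
open import Data.Product using (_×_; _,_; proj₂; uncurry)
open import Data.Sum using (_⊎_; inj₁; inj₂; [_,_]′)
open import Algebra.Bundles using (CommutativeRing)
open import Relation.Binary.PropositionalEquality as ≡ using (_≡_; _≢_)
open import Relation.Nullary using (¬_; contradiction; yes; no)
open import Relation.Nullary.Decidable using (T?)
open import Relation.Nullary.Reflects using (Reflects; ofʸ; ofⁿ; _×-reflects_; _⊎-reflects_; det)

reflects-map : ∀ {a b} {A : Set a} {B : Set b} {x : Bool} → (A → B) → (B → A) → Reflects A x → Reflects B x
reflects-map f g (ofʸ a)  = ofʸ (f a)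
reflects-map f g (ofⁿ ¬a) = ofⁿ (¬a ∘ g)

reflects-toWitness : ∀ {a} {A : Set a} {x : Bool} → Reflects A x → T x → A
reflects-toWitness (ofʸ a) _ = a

reflects-fromWitness : ∀ {a} {A : Set a} {x : Bool} → Reflects A x → A → T x
reflects-fromWitness (ofʸ _)  _ = _
reflects-fromWitness (ofⁿ ¬a) a = ¬a a

private
  variable
    n : ℕ

memb-reflects : (e : Fin n) (S : Subset n) → Reflects (e ∈ S) (memb e S)
memb-reflects Fin.zero    (inside  ∷ S) = ofʸ here
memb-reflects Fin.zero    (outside ∷ S) = ofⁿ λ ()
memb-reflects (Fin.suc e) (b ∷ S)       = reflects-map there drop-there (memb-reflects e S)

⊆ᵇ-reflects : (S T : Subset n) → Reflects (S ⊆ T) (S ⊆ᵇ T)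
⊆ᵇ-reflects []            []            = ofʸ λ ()
⊆ᵇ-reflects (outside ∷ S) (b ∷ T)       = reflects-map out⊆ drop-∷-⊆ (⊆ᵇ-reflects S T)
⊆ᵇ-reflects (inside ∷ S)  (inside ∷ T)  = reflects-map s⊆s drop-∷-⊆ (⊆ᵇ-reflects S T)
⊆ᵇ-reflects (inside ∷ S)  (outside ∷ T) = ofⁿ λ S⊆T → contradiction (S⊆T here) λ ()

≡ˢ-reflects : (S T : Subset n) → Reflects (S ≡ T) (S ≡ˢ T)
≡ˢ-reflects []            []            = ofʸ ≡.refl
≡ˢ-reflects (inside ∷ S)  (inside ∷ T)  = reflects-map (≡.cong (inside ∷_)) ∷-injectiveʳ (≡ˢ-reflects S T)
≡ˢ-reflects (outside ∷ S) (outside ∷ T) = reflects-map (≡.cong (outside ∷_)) ∷-injectiveʳ (≡ˢ-reflects S T)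
≡ˢ-reflects (inside ∷ S)  (outside ∷ T) = ofⁿ λ ()
≡ˢ-reflects (outside ∷ S) (inside ∷ T)  = ofⁿ λ ()

⊆ᵇ-antisym-reflects : (S T : Subset n) → Reflects (T ≡ S) ((S ⊆ᵇ T) ∧ (T ⊆ᵇ S))
⊆ᵇ-antisym-reflects S T =
  reflects-map antisym (λ { ≡.refl → ⊆-refl , ⊆-refl }) (⊆ᵇ-reflects S T ×-reflects ⊆ᵇ-reflects T S)
  where
  antisym : S ⊆ T × T ⊆ S → T ≡ S
  antisym (S⊆T , T⊆S) = ⊆-antisym T⊆S S⊆T

⊂⇒∣∣< : {S T : Subset n} → S ⊆ T → S ≢ T → ∣ S ∣ < ∣ T ∣
⊂⇒∣∣< {S = []}          {[]}          _   S≢T = contradiction ≡.refl S≢T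
⊂⇒∣∣< {S = outside ∷ S} {outside ∷ T} S⊆T S≢T = ⊂⇒∣∣< (drop-∷-⊆ S⊆T) (S≢T ∘ ≡.cong (outside ∷_))
⊂⇒∣∣< {S = outside ∷ S} {inside ∷ T}  S⊆T _   = s≤s (p⊆q⇒∣p∣≤∣q∣ (drop-∷-⊆ S⊆T))
⊂⇒∣∣< {S = inside ∷ S}  {outside ∷ T} S⊆T _   with () ← S⊆T here
⊂⇒∣∣< {S = inside ∷ S}  {inside ∷ T}  S⊆T S≢T = s≤s (⊂⇒∣∣< (drop-∷-⊆ S⊆T) (S≢T ∘ ≡.cong (inside ∷_)))

all-reflects : ∀ {A : Set} {P : A → Set} {p : A → Bool} →
               (∀ a → Reflects (P a) (p a)) → ∀ xs → Reflects (All P xs) (all p xs)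
all-reflects r []       = ofʸ []
all-reflects r (a ∷ xs) = reflects-map (uncurry _∷_) All.uncons (r a ×-reflects all-reflects r xs)

∪-least : {P Q S : Subset n} → P ⊆ S → Q ⊆ S → P ∪ Q ⊆ S
∪-least {P = P} {Q} P⊆S Q⊆S = [ P⊆S , Q⊆S ]′ ∘ x∈p∪q⁻ P Q

module Sums {c ℓ : Level} (R : CommutativeRing c ℓ) where

  open CommutativeRing R
  open import Algebra.Properties.CommutativeSemigroup +-commutativeSemigroup using () renaming (interchange to +-interchange)
  open import Relation.Binary.Reasoning.Setoid setoid

  ∑ : {A : Set} → List A → (A → Carrier) → Carrier
  ∑ = sumL R

  infix 5 ∑
  syntax ∑ xs (λ a → f) = ∑[ a ∈ xs ] f

  infixr 8 [_]_
  [_]_ : Bool → Carrier → Carrier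
  [ b ] x = if b then x else 0#

  variable
    A B : Set
    f g : A → Carrier

  ∑-cong : ∀ xs → (∀ a → f a ≈ g a) → ∑ xs f ≈ ∑ xs g
  ∑-cong []       f≈g = refl
  ∑-cong (a ∷ xs) f≈g = +-cong (f≈g a) (∑-cong xs f≈g)

  ∑-cong-∈ : ∀ xs → (∀ {a} → a ∈ₗ xs → f a ≈ g a) → ∑ xs f ≈ ∑ xs g
  ∑-cong-∈ []       f≈g = refl
  ∑-cong-∈ (a ∷ xs) f≈g = +-cong (f≈g (here ≡.refl)) (∑-cong-∈ xs (f≈g ∘ there))

  ∑-zero : ∀ xs → (∀ a → f a ≈ 0#) → ∑ xs f ≈ 0#
  ∑-zero []       f≈0 = refl
  ∑-zero (a ∷ xs) f≈0 = trans (+-cong (f≈0 a) (∑-zero xs f≈0)) (+-identityʳ 0#)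

  ∑-+ : ∀ xs → ∑ xs (λ a → f a + g a) ≈ ∑ xs f + ∑ xs g
  ∑-+ []       = sym (+-identityʳ 0#)
  ∑-+ {f = f} {g = g} (a ∷ xs) = trans (+-congˡ (∑-+ xs)) (+-interchange (f a) (g a) _ _)

  *-distribˡ-∑ : ∀ k xs → k * ∑ xs f ≈ ∑[ a ∈ xs ] (k * f a)
  *-distribˡ-∑ k []       = zeroʳ k
  *-distribˡ-∑ k (a ∷ xs) = trans (distribˡ k _ _) (+-congˡ (*-distribˡ-∑ k xs))

  *-distribʳ-∑ : ∀ k xs → ∑ xs f * k ≈ ∑[ a ∈ xs ] (f a * k)
  *-distribʳ-∑ k xs = trans (*-comm _ k) (trans (*-distribˡ-∑ k xs) (∑-cong xs λ a → *-comm k _))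

  ∑*∑ : ∀ xs ys → ∑ xs f * ∑ ys g ≈ ∑[ a ∈ xs ] ∑[ b ∈ ys ] (f a * g b)
  ∑*∑ xs ys = trans (*-distribʳ-∑ _ xs) (∑-cong xs λ a → *-distribˡ-∑ _ ys)

  ∑-++ : ∀ xs ys → ∑ (xs ++ ys) f ≈ ∑ xs f + ∑ ys f
  ∑-++ []       ys = sym (+-identityˡ _)
  ∑-++ (a ∷ xs) ys = trans (+-congˡ (∑-++ xs ys)) (sym (+-assoc _ _ _))

  ∑-map : (h : A → B) (xs : List A) {f : B → Carrier} → ∑ (map h xs) f ≡ ∑[ a ∈ xs ] f (h a)
  ∑-map h []       = ≡.refl
  ∑-map h (a ∷ xs) = ≡.cong (_ +_) (∑-map h xs)

  ∑-comm : ∀ xs ys {h : A → B → Carrier} → ∑[ a ∈ xs ] ∑[ b ∈ ys ] h a b ≈ ∑[ b ∈ ys ] ∑[ a ∈ xs ] h a b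
  ∑-comm []       ys = sym (∑-zero ys λ _ → refl)
  ∑-comm (a ∷ xs) ys = trans (+-congˡ (∑-comm xs ys)) (sym (∑-+ ys))

  ∑²-comm : ∀ {C D : Set} xs ys (zs : List C) (ws : List D) {h : A → B → C → D → Carrier} →
            (∑[ a ∈ xs ] ∑[ b ∈ ys ] ∑[ c ∈ zs ] ∑[ d ∈ ws ] h a b c d)
              ≈ (∑[ c ∈ zs ] ∑[ d ∈ ws ] ∑[ a ∈ xs ] ∑[ b ∈ ys ] h a b c d)
  ∑²-comm xs ys zs ws = begin
    _ ≈⟨ ∑-cong xs (λ a → ∑-comm ys zs) ⟩
    _ ≈⟨ ∑-comm xs zs ⟩
    _ ≈⟨ ∑-cong zs (λ c → ∑-cong xs λ a → ∑-comm ys ws) ⟩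
    _ ≈⟨ ∑-cong zs (λ c → ∑-comm xs ws) ⟩
    _ ∎

  ∑-filter : (p : A → Bool) (xs : List A) → ∑ (filter (λ a → T? (p a)) xs) f ≈ ∑[ a ∈ xs ] [ p a ] f a
  ∑-filter p []       = refl
  ∑-filter p (a ∷ xs) with p a
  ... | true  = +-congˡ (∑-filter p xs)
  ... | false = trans (∑-filter p xs) (sym (+-identityˡ _))

  [_]-zero : ∀ b → [ b ] 0# ≈ 0#
  [ true  ]-zero = refl
  [ false ]-zero = refl

  [_]-cong : ∀ b {x y} → x ≈ y → [ b ] x ≈ [ b ] y
  [ true  ]-cong x≈y = x≈y
  [ false ]-cong x≈y = refl

  *-[] : ∀ k b x → k * [ b ] x ≈ [ b ] (k * x)
  *-[] k true  x = refl
  *-[] k false x = zeroʳ k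

  []-* : ∀ b x k → [ b ] x * k ≈ [ b ] (x * k)
  []-* true  x k = refl
  []-* false x k = zeroˡ k

  []-comm : ∀ p q x → [ p ] [ q ] x ≈ [ q ] [ p ] x
  []-comm true  q x = refl
  []-comm false q x = sym [ q ]-zero

  []-∑ : ∀ b xs → [ b ] ∑ xs f ≈ ∑[ a ∈ xs ] [ b ] f a
  []-∑ true  xs = refl
  []-∑ false xs = sym (∑-zero xs λ _ → refl)

  *-distribˡ-∑[][] : ∀ k xs (p q : A → Bool) → k * (∑[ a ∈ xs ] [ p a ] [ q a ] f a) ≈ ∑[ a ∈ xs ] [ p a ] [ q a ] (k * f a)
  *-distribˡ-∑[][] k xs p q =
    trans (*-distribˡ-∑ k xs) (∑-cong xs λ a → trans (*-[] k (p a) _) ([ p a ]-cong (*-[] k (q a) _)))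

  []-by-cases : ∀ {a} {P : Set a} {b y x} → Reflects P b → (P → y ≈ x) → (¬ P → y ≈ 0#) → y ≈ [ b ] x
  []-by-cases (ofʸ p)  y≈x _   = y≈x p
  []-by-cases (ofⁿ ¬p) _   y≈0 = y≈0 ¬p

  []-split : ∀ p q x → (T q → T p) → [ p ∧ not q ] x + [ q ] x ≈ [ p ] x
  []-split p     false x _     = trans (+-identityʳ _) (reflexive (≡.cong (λ b → [ b ] x) (∧-identityʳ p)))
  []-split true  true  x _     = +-identityˡ x
  []-split false true  x q⇒p   = ⊥-elim (q⇒p _)

  []-gather : ∀ a b c u v w → [ a ] (([ b ] u * [ c ] v) * w) ≈ [ a ] [ b ] [ c ] w * (u * v)
  []-gather false b     c     u v w = sym (zeroˡ _)
  []-gather true  false c     u v w = trans (*-congʳ (zeroˡ _)) (trans (zeroˡ w) (sym (zeroˡ _)))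
  []-gather true  true  false u v w = trans (*-congʳ (zeroʳ u)) (trans (zeroˡ w) (sym (zeroˡ _)))
  []-gather true  true  true  u v w = *-comm _ _

module SubsetSums {c ℓ : Level} (R : CommutativeRing c ℓ) where

  open CommutativeRing R
  open Sums R
  open import Algebra.Properties.Ring ring using (-1*x≈-x; -‿involutive)
  open import Algebra.Properties.CommutativeSemiring.Exp commutativeSemiring using (_^_; ^-homo-*; ^-distrib-*)
  open import Algebra.Properties.CommutativeSemigroup *-commutativeSemigroup using () renaming (interchange to *-interchange)
  open import Relation.Binary.Reasoning.Setoid setoid

  pow≡^ : ∀ x k → pow R x k ≡ x ^ k
  pow≡^ x zero    = ≡.refl
  pow≡^ x (suc k) = ≡.cong (x *_) (pow≡^ x k)

  pow-homo-* : ∀ x m k → pow R x (m ℕ.+ k) ≈ pow R x m * pow R x k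
  pow-homo-* x m k rewrite pow≡^ x (m ℕ.+ k) | pow≡^ x m | pow≡^ x k = ^-homo-* x m k

  pow-distrib-* : ∀ x y k → pow R (x * y) k ≈ pow R x k * pow R y k
  pow-distrib-* x y k rewrite pow≡^ (x * y) k | pow≡^ x k | pow≡^ y k = ^-distrib-* x y k

  pow-cong : ∀ {x y} k → x ≈ y → pow R x k ≈ pow R y k
  pow-cong zero    x≈y = refl
  pow-cong (suc k) x≈y = *-cong x≈y (pow-cong k x≈y)

  sign : ℕ → Carrier
  sign = pow R (- 1#)

  sign-square : ∀ k → sign k * sign k ≈ 1#
  sign-square zero    = *-identityˡ 1#
  sign-square (suc k) = begin
    (- 1# * sign k) * (- 1# * sign k) ≈⟨ *-interchange _ _ _ _ ⟩
    (- 1# * - 1#) * (sign k * sign k) ≈⟨ *-cong (trans (-1*x≈-x (- 1#)) (-‿involutive 1#)) (sign-square k) ⟩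
    1# * 1#                           ≈⟨ *-identityˡ 1# ⟩
    1#                                ∎

  sign-even : ∀ m k → sign (m ℕ.+ (k ℕ.+ k)) ≈ sign m
  sign-even m k = begin
    sign (m ℕ.+ (k ℕ.+ k))        ≈⟨ pow-homo-* (- 1#) m _ ⟩
    sign m * sign (k ℕ.+ k)       ≈⟨ *-congˡ (trans (pow-homo-* (- 1#) k k) (sign-square k)) ⟩
    sign m * 1#                   ≈⟨ *-identityʳ _ ⟩
    sign m                        ∎

  sign-shift² : ∀ r m k → sign (r ℕ.+ m) * sign (r ℕ.+ k) ≈ sign m * sign k
  sign-shift² r m k = begin
    sign (r ℕ.+ m) * sign (r ℕ.+ k)           ≈⟨ *-cong (pow-homo-* (- 1#) r m) (pow-homo-* (- 1#) r k) ⟩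
    (sign r * sign m) * (sign r * sign k)     ≈⟨ *-interchange _ _ _ _ ⟩
    (sign r * sign r) * (sign m * sign k)     ≈⟨ *-congʳ (sign-square r) ⟩
    1# * (sign m * sign k)                    ≈⟨ *-identityˡ _ ⟩
    sign m * sign k                           ∎

  ∑-subsets-suc : ∀ n (h : Subset (suc n) → Carrier) →
                  ∑ (subsets (suc n)) h ≈ (∑[ S ∈ subsets n ] h (outside ∷ S)) + (∑[ S ∈ subsets n ] h (inside ∷ S))
  ∑-subsets-suc n h = trans (∑-++ (map (outside ∷_) (subsets n)) _)
    (+-cong (reflexive (∑-map (outside ∷_) (subsets n))) (reflexive (∑-map (inside ∷_) (subsets n))))

  ∑-δ : (W : Subset n) (h : Subset n → Carrier) → ∑[ Z ∈ subsets n ] [ Z ≡ˢ W ] h Z ≈ h W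
  ∑-δ []            h = +-identityʳ (h [])
  ∑-δ {suc n} (outside ∷ W) h = begin
    ∑[ Z ∈ subsets (suc n) ] [ Z ≡ˢ (outside ∷ W) ] h Z
      ≈⟨ ∑-subsets-suc n _ ⟩
    (∑[ Z ∈ subsets n ] [ Z ≡ˢ W ] h (outside ∷ Z)) + (∑[ Z ∈ subsets n ] 0#)
      ≈⟨ +-cong (∑-δ W _) (∑-zero (subsets n) λ _ → refl) ⟩
    h (outside ∷ W) + 0#
      ≈⟨ +-identityʳ _ ⟩
    h (outside ∷ W) ∎
  ∑-δ {suc n} (inside ∷ W)  h = begin
    ∑[ Z ∈ subsets (suc n) ] [ Z ≡ˢ (inside ∷ W) ] h Z
      ≈⟨ ∑-subsets-suc n _ ⟩
    (∑[ Z ∈ subsets n ] 0#) + (∑[ Z ∈ subsets n ] [ Z ≡ˢ W ] h (inside ∷ Z))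
      ≈⟨ +-cong (∑-zero (subsets n) λ _ → refl) (∑-δ W _) ⟩
    0# + h (inside ∷ W)
      ≈⟨ +-identityˡ _ ⟩
    h (inside ∷ W) ∎

  ∑-alternating : (L U : Subset n) → ∑[ S ∈ subsets n ] [ L ⊆ᵇ S ] [ S ⊆ᵇ U ] sign ∣ S ∣ ≈ [ L ≡ˢ U ] sign ∣ L ∣
  ∑-alternating []            []            = +-identityʳ 1#
  ∑-alternating {suc n} (outside ∷ L) (outside ∷ U) = begin
    _                                                 ≈⟨ ∑-subsets-suc n _ ⟩
    (∑[ S ∈ subsets n ] [ L ⊆ᵇ S ] [ S ⊆ᵇ U ] sign ∣ S ∣) + (∑[ S ∈ subsets n ] [ L ⊆ᵇ S ] 0#)
      ≈⟨ +-cong (∑-alternating L U) (∑-zero (subsets n) λ S → [ L ⊆ᵇ S ]-zero) ⟩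
    [ L ≡ˢ U ] sign ∣ L ∣ + 0#                         ≈⟨ +-identityʳ _ ⟩
    [ L ≡ˢ U ] sign ∣ L ∣                              ∎
  ∑-alternating {suc n} (outside ∷ L) (inside ∷ U)  = begin
    _                                                 ≈⟨ ∑-subsets-suc n _ ⟩
    (∑[ S ∈ subsets n ] [ L ⊆ᵇ S ] [ S ⊆ᵇ U ] sign ∣ S ∣) + (∑[ S ∈ subsets n ] [ L ⊆ᵇ S ] [ S ⊆ᵇ U ] (- 1# * sign ∣ S ∣))
      ≈⟨ +-congˡ (*-distribˡ-∑[][] (- 1#) (subsets n) (L ⊆ᵇ_) (_⊆ᵇ U)) ⟨
    x + - 1# * x                                      ≈⟨ +-congˡ (-1*x≈-x x) ⟩
    x + - x                                           ≈⟨ -‿inverseʳ x ⟩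
    0#                                                ∎
    where
    x : Carrier
    x = ∑[ S ∈ subsets n ] [ L ⊆ᵇ S ] [ S ⊆ᵇ U ] sign ∣ S ∣
  ∑-alternating {suc n} (inside ∷ L)  (outside ∷ U) = begin
    _                                                 ≈⟨ ∑-subsets-suc n _ ⟩
    (∑[ S ∈ subsets n ] 0#) + (∑[ S ∈ subsets n ] [ L ⊆ᵇ S ] 0#)
      ≈⟨ +-cong (∑-zero (subsets n) λ _ → refl) (∑-zero (subsets n) λ S → [ L ⊆ᵇ S ]-zero) ⟩
    0# + 0#                                           ≈⟨ +-identityʳ 0# ⟩
    0#                                                ∎
  ∑-alternating {suc n} (inside ∷ L)  (inside ∷ U)  = begin
    _                                                 ≈⟨ ∑-subsets-suc n _ ⟩
    (∑[ S ∈ subsets n ] 0#) + (∑[ S ∈ subsets n ] [ L ⊆ᵇ S ] [ S ⊆ᵇ U ] (- 1# * sign ∣ S ∣))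
      ≈⟨ +-cong (∑-zero (subsets n) λ _ → refl) (sym (*-distribˡ-∑[][] (- 1#) (subsets n) (L ⊆ᵇ_) (_⊆ᵇ U))) ⟩
    0# + - 1# * (∑[ S ∈ subsets n ] [ L ⊆ᵇ S ] [ S ⊆ᵇ U ] sign ∣ S ∣) ≈⟨ +-identityˡ _ ⟩
    - 1# * (∑[ S ∈ subsets n ] [ L ⊆ᵇ S ] [ S ⊆ᵇ U ] sign ∣ S ∣)      ≈⟨ *-congˡ (∑-alternating L U) ⟩
    - 1# * [ L ≡ˢ U ] sign ∣ L ∣                       ≈⟨ *-[] (- 1#) (L ≡ˢ U) _ ⟩
    [ L ≡ˢ U ] (- 1# * sign ∣ L ∣)                     ∎

module Closure {n : ℕ} (M : Matroid n) where

  open Matroid M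
  open MatroidDefs M using (isFlat; crk; nullity)
  open import Algebra.Properties.CommutativeSemigroup ℕ.+-commutativeSemigroup using () renaming (interchange to ℕ-interchange)

  Flat : Subset n → Set
  Flat X = ∀ e → e ∈ X ⊎ rk X < rk (X ∪ ⁅ e ⁆)

  isFlat-reflects : ∀ X → Reflects (Flat X) (isFlat X)
  isFlat-reflects X = reflects-map (λ h e → All.lookup h (∈-allFin e)) (λ h → All.tabulate λ {e} _ → h e)
    (all-reflects (λ e → memb-reflects e X ⊎-reflects <ᵇ-reflects-< (rk X) _) (allFin n))

  flat-absorbs : ∀ {S Y e} → Flat Y → S ⊆ Y → rk (S ∪ ⁅ e ⁆) ≤ rk S → e ∈ Y
  flat-absorbs {S} {Y} {e} flatY S⊆Y rk≤ with flatY e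
  ... | inj₁ e∈Y   = e∈Y
  ... | inj₂ rk<rk = contradiction (ℕ.+-cancelʳ-≤ (rk I) _ _ (begin
    rk (Y ∪ ⁅ e ⁆) ℕ.+ rk I  ≤⟨ ℕ.+-monoˡ-≤ (rk I) (rk-mono (∪-least (p⊆p∪q B) (q⊆p∪q Y B ∘ q⊆p∪q S ⁅ e ⁆))) ⟩
    rk (Y ∪ B) ℕ.+ rk I      ≤⟨ rk-submod Y B ⟩
    rk Y ℕ.+ rk B            ≤⟨ ℕ.+-monoʳ-≤ (rk Y) (ℕ.≤-trans rk≤ (rk-mono λ x∈S → x∈p∩q⁺ (S⊆Y x∈S , p⊆p∪q ⁅ e ⁆ x∈S))) ⟩
    rk Y ℕ.+ rk I            ∎)) (ℕ.<⇒≱ rk<rk)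
    where
    open ℕ.≤-Reasoning
    B I : Subset n
    B = S ∪ ⁅ e ⁆
    I = Y ∩ B

  addIfSpanned : Subset n → Fin n → Subset n
  addIfSpanned Y e with rk (Y ∪ ⁅ e ⁆) ℕ.≟ rk Y
  ... | yes _ = Y ∪ ⁅ e ⁆
  ... | no  _ = Y

  ⊆-addIfSpanned : ∀ Y e → Y ⊆ addIfSpanned Y e
  ⊆-addIfSpanned Y e with rk (Y ∪ ⁅ e ⁆) ℕ.≟ rk Y
  ... | yes _ = p⊆p∪q ⁅ e ⁆
  ... | no  _ = id

  rk-addIfSpanned : ∀ Y e → rk (addIfSpanned Y e) ≡ rk Y
  rk-addIfSpanned Y e with rk (Y ∪ ⁅ e ⁆) ℕ.≟ rk Y
  ... | yes eq = eq
  ... | no  _  = ≡.refl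

  closeOver : List (Fin n) → Subset n → Subset n
  closeOver es Y = foldl addIfSpanned Y es

  ⊆-closeOver : ∀ es Y → Y ⊆ closeOver es Y
  ⊆-closeOver []       Y = id
  ⊆-closeOver (e ∷ es) Y = ⊆-closeOver es (addIfSpanned Y e) ∘ ⊆-addIfSpanned Y e

  rk-closeOver : ∀ es Y → rk (closeOver es Y) ≡ rk Y
  rk-closeOver []       Y = ≡.refl
  rk-closeOver (e ∷ es) Y = ≡.trans (rk-closeOver es (addIfSpanned Y e)) (rk-addIfSpanned Y e)

  closeOver-closed : ∀ es Y {e} → e ∈ₗ es → e ∈ closeOver es Y ⊎ rk (closeOver es Y) < rk (closeOver es Y ∪ ⁅ e ⁆)
  closeOver-closed (e ∷ es) Y (here ≡.refl) with rk (Y ∪ ⁅ e ⁆) ℕ.≟ rk Y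
  ... | yes _     = inj₁ (⊆-closeOver es (Y ∪ ⁅ e ⁆) (q⊆p∪q Y ⁅ e ⁆ (x∈⁅x⁆ e)))
  ... | no  rk≢rk = inj₂ (begin-strict
    rk (closeOver es Y)         ≡⟨ rk-closeOver es Y ⟩
    rk Y                        <⟨ ℕ.≤∧≢⇒< (rk-mono (p⊆p∪q ⁅ e ⁆)) (rk≢rk ∘ ≡.sym) ⟩
    rk (Y ∪ ⁅ e ⁆)              ≤⟨ rk-mono (∪-least (p⊆p∪q ⁅ e ⁆ ∘ ⊆-closeOver es Y) (q⊆p∪q _ ⁅ e ⁆)) ⟩
    rk (closeOver es Y ∪ ⁅ e ⁆) ∎)
    where open ℕ.≤-Reasoning
  closeOver-closed (e′ ∷ es) Y (there e∈es) = closeOver-closed es (addIfSpanned Y e′) e∈es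

  cl : Subset n → Subset n
  cl = closeOver (allFin n)

  ⊆-cl : ∀ S → S ⊆ cl S
  ⊆-cl = ⊆-closeOver (allFin n)

  rk-cl : ∀ S → rk (cl S) ≡ rk S
  rk-cl = rk-closeOver (allFin n)

  cl-flat : ∀ S → Flat (cl S)
  cl-flat S e = closeOver-closed (allFin n) S (∈-allFin e)

  cl-least : ∀ {S Y} → Flat Y → S ⊆ Y → cl S ⊆ Y
  cl-least {S} flatY S⊆Y {e} e∈clS = flat-absorbs flatY S⊆Y (begin
    rk (S ∪ ⁅ e ⁆) ≤⟨ rk-mono (∪-least (⊆-cl S) (λ x∈⁅e⁆ → ≡.subst (_∈ cl S) (≡.sym (x∈⁅y⁆⇒x≡y e x∈⁅e⁆)) e∈clS)) ⟩
    rk (cl S)      ≡⟨ rk-cl S ⟩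
    rk S           ∎)
    where open ℕ.≤-Reasoning

  cl-mono : ∀ {S T} → S ⊆ T → cl S ⊆ cl T
  cl-mono {T = T} S⊆T = cl-least (cl-flat T) (⊆-cl T ∘ S⊆T)

  cl-fixes-flat : ∀ {Y} → Flat Y → cl Y ≡ Y
  cl-fixes-flat flatY = ⊆-antisym (cl-least flatY id) (⊆-cl _)

  crk-cl : ∀ S → crk (cl S) ≡ crk S
  crk-cl S = ≡.cong (rk ⊤ ∸_) (rk-cl S)

  rank-parity : ∀ S → (crk S ℕ.+ nullity S) ℕ.+ (rk S ℕ.+ rk S) ≡ rk ⊤ ℕ.+ ∣ S ∣
  rank-parity S = ≡.trans (ℕ-interchange (crk S) (nullity S) (rk S) (rk S))
    (≡.cong₂ ℕ._+_ (ℕ.m∸n+n≡m (rk-mono (⊆⊤ {p = S}))) (ℕ.m∸n+n≡m (rk-bounded S)))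

module Möbius {c ℓ : Level} (R : CommutativeRing c ℓ) {n : ℕ} (M : Matroid n) where

  open CommutativeRing R
  open Sums R
  open SubsetSums R
  open Matroid M
  open MatroidDefs M
  open Closure M
  open import Algebra.Properties.Group +-group using (inverseʳ-unique)
  open import Algebra.Properties.CommutativeSemigroup *-commutativeSemigroup using () renaming (interchange to *-interchange)
  open import Algebra.Properties.AbelianGroup +-abelianGroup using (xyx⁻¹≈y)
  open import Algebra.Properties.Ring ring using (-‿distribʳ-*)
  open import Relation.Binary.Reasoning.Setoid setoid

  𝒮 : List (Subset n)
  𝒮 = subsets n

  ∈flats⇒Flat : ∀ {X} → X ∈ₗ flats → Flat X
  ∈flats⇒Flat {X} X∈flats = reflects-toWitness (isFlat-reflects X) (proj₂ (∈-filter⁻ (λ Z → T? (isFlat Z)) {xs = 𝒮} X∈flats))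

  ∑-flats-δ : ∀ {W} → Flat W → (h : Subset n → Carrier) → ∑[ Z ∈ flats ] [ Z ≡ˢ W ] h Z ≈ h W
  ∑-flats-δ {W} flatW h = begin
    ∑[ Z ∈ flats ] [ Z ≡ˢ W ] h Z                ≈⟨ ∑-filter isFlat 𝒮 ⟩
    ∑[ Z ∈ 𝒮 ] [ isFlat Z ] [ Z ≡ˢ W ] h Z       ≈⟨ ∑-cong 𝒮 only-W-counts ⟩
    ∑[ Z ∈ 𝒮 ] [ Z ≡ˢ W ] h Z                    ≈⟨ ∑-δ W h ⟩
    h W                                          ∎
    where
    only-W-counts : ∀ Z → [ isFlat Z ] [ Z ≡ˢ W ] h Z ≈ [ Z ≡ˢ W ] h Z
    only-W-counts Z with Z ≡ˢ W | ≡ˢ-reflects Z W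
    ... | _ | ofⁿ _      = [ isFlat Z ]-zero
    ... | _ | ofʸ ≡.refl with isFlat Z | isFlat-reflects Z
    ...   | _ | ofʸ _     = refl
    ...   | _ | ofⁿ ¬flat = contradiction flatW ¬flat

  interval halfOpenInterval : Subset n → Subset n → Subset n → Bool
  interval         X Y Z = (X ⊆ᵇ Z) ∧ (Z ⊆ᵇ Y)
  halfOpenInterval X Y Z = (X ⊆ᵇ Z) ∧ (Z ⊆ᵇ Y) ∧ not (Z ≡ˢ Y)

  spanTerm : Subset n → Subset n → Subset n → Subset n → Carrier
  spanTerm X Y S₁ S₂ = [ S₁ ⊆ᵇ S₂ ] [ X ≡ˢ cl S₁ ] [ Y ≡ˢ cl S₂ ] (sign ∣ S₁ ∣ * sign ∣ S₂ ∣)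

  signedSpans : Subset n → Subset n → Carrier
  signedSpans X Y = ∑[ S₁ ∈ 𝒮 ] ∑[ S₂ ∈ 𝒮 ] spanTerm X Y S₁ S₂

  signedSpans-⊈ : ∀ {X Y} → ¬ X ⊆ Y → signedSpans X Y ≈ 0#
  signedSpans-⊈ {X} {Y} X⊈Y = ∑-zero 𝒮 λ S₁ → ∑-zero 𝒮 λ S₂ → spanTerm-vanishes S₁ S₂
    where
    spanTerm-vanishes : ∀ S₁ S₂ → spanTerm X Y S₁ S₂ ≈ 0#
    spanTerm-vanishes S₁ S₂
      with S₁ ⊆ᵇ S₂ | ⊆ᵇ-reflects S₁ S₂ | X ≡ˢ cl S₁ | ≡ˢ-reflects X (cl S₁) | Y ≡ˢ cl S₂ | ≡ˢ-reflects Y (cl S₂)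
    ... | _ | ofⁿ _     | _ | _          | _ | _          = refl
    ... | _ | ofʸ _     | _ | ofⁿ _      | _ | _          = refl
    ... | _ | ofʸ _     | _ | ofʸ _      | _ | ofⁿ _      = refl
    ... | _ | ofʸ S₁⊆S₂ | _ | ofʸ ≡.refl | _ | ofʸ ≡.refl = ⊥-elim (X⊈Y (cl-mono S₁⊆S₂))

  ∑-interval-cl : ∀ {X Y} → Flat Y → ∀ S₁ S₂ {x} →
    ∑[ Z ∈ flats ] [ interval X Y Z ] [ S₁ ⊆ᵇ S₂ ] [ X ≡ˢ cl S₁ ] [ Z ≡ˢ cl S₂ ] x
      ≈ [ S₁ ⊆ᵇ S₂ ] [ X ≡ˢ cl S₁ ] [ S₂ ⊆ᵇ Y ] x
  ∑-interval-cl {X} {Y} flatY S₁ S₂ {x}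
    with S₁ ⊆ᵇ S₂ | ⊆ᵇ-reflects S₁ S₂ | X ≡ˢ cl S₁ | ≡ˢ-reflects X (cl S₁)
  ... | _ | ofⁿ _     | _ | _          = ∑-zero flats λ Z → [ interval X Y Z ]-zero
  ... | _ | ofʸ _     | _ | ofⁿ _      = ∑-zero flats λ Z → [ interval X Y Z ]-zero
  ... | _ | ofʸ S₁⊆S₂ | _ | ofʸ ≡.refl = begin
    ∑[ Z ∈ flats ] [ interval X Y Z ] [ Z ≡ˢ cl S₂ ] x   ≈⟨ ∑-cong flats (λ Z → []-comm (interval X Y Z) _ x) ⟩
    ∑[ Z ∈ flats ] [ Z ≡ˢ cl S₂ ] [ interval X Y Z ] x   ≈⟨ ∑-flats-δ (cl-flat S₂) (λ Z → [ interval X Y Z ] x) ⟩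
    [ interval X Y (cl S₂) ] x                           ≡⟨ ≡.cong (λ b → [ b ] x) (det cl-between-reflects (⊆ᵇ-reflects S₂ Y)) ⟩
    [ S₂ ⊆ᵇ Y ] x                                        ∎
    where
    cl-between-reflects : Reflects (S₂ ⊆ Y) (interval X Y (cl S₂))
    cl-between-reflects = reflects-map to from (⊆ᵇ-reflects X (cl S₂) ×-reflects ⊆ᵇ-reflects (cl S₂) Y)
      where
      to : X ⊆ cl S₂ × cl S₂ ⊆ Y → S₂ ⊆ Y
      to (_ , clS₂⊆Y) = clS₂⊆Y ∘ ⊆-cl S₂
      from : S₂ ⊆ Y → X ⊆ cl S₂ × cl S₂ ⊆ Y
      from S₂⊆Y = cl-mono S₁⊆S₂ , cl-least flatY S₂⊆Y

  signedSpans-interval : ∀ {X Y} → Flat Y → ∑[ Z ∈ flats ] [ interval X Y Z ] signedSpans X Z ≈ [ X ≡ˢ Y ] 1#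
  signedSpans-interval {X} {Y} flatY = begin
    ∑[ Z ∈ flats ] [ interval X Y Z ] signedSpans X Z
      ≈⟨ ∑-cong flats (λ Z → trans ([]-∑ (interval X Y Z) 𝒮) (∑-cong 𝒮 λ S₁ → []-∑ (interval X Y Z) 𝒮)) ⟩
    ∑[ Z ∈ flats ] ∑[ S₁ ∈ 𝒮 ] ∑[ S₂ ∈ 𝒮 ] [ interval X Y Z ] spanTerm X Z S₁ S₂
      ≈⟨ ∑-comm flats 𝒮 ⟩
    ∑[ S₁ ∈ 𝒮 ] ∑[ Z ∈ flats ] ∑[ S₂ ∈ 𝒮 ] [ interval X Y Z ] spanTerm X Z S₁ S₂
      ≈⟨ ∑-cong 𝒮 (λ S₁ → ∑-comm flats 𝒮 {h = λ Z S₂ → [ interval X Y Z ] spanTerm X Z S₁ S₂}) ⟩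
    ∑[ S₁ ∈ 𝒮 ] ∑[ S₂ ∈ 𝒮 ] ∑[ Z ∈ flats ] [ interval X Y Z ] spanTerm X Z S₁ S₂
      ≈⟨ ∑-cong 𝒮 (λ S₁ → ∑-cong 𝒮 λ S₂ → ∑-interval-cl {X} flatY S₁ S₂) ⟩
    ∑[ S₁ ∈ 𝒮 ] ∑[ S₂ ∈ 𝒮 ] [ S₁ ⊆ᵇ S₂ ] [ X ≡ˢ cl S₁ ] [ S₂ ⊆ᵇ Y ] (sign ∣ S₁ ∣ * sign ∣ S₂ ∣)
      ≈⟨ ∑-cong 𝒮 factor-S₂ ⟩
    ∑[ S₁ ∈ 𝒮 ] [ X ≡ˢ cl S₁ ] (sign ∣ S₁ ∣ * (∑[ S₂ ∈ 𝒮 ] [ S₁ ⊆ᵇ S₂ ] [ S₂ ⊆ᵇ Y ] sign ∣ S₂ ∣))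
      ≈⟨ ∑-cong 𝒮 (λ S₁ → [ X ≡ˢ cl S₁ ]-cong (*-congˡ (∑-alternating S₁ Y))) ⟩
    ∑[ S₁ ∈ 𝒮 ] [ X ≡ˢ cl S₁ ] (sign ∣ S₁ ∣ * [ S₁ ≡ˢ Y ] sign ∣ S₁ ∣)
      ≈⟨ ∑-cong 𝒮 sign-cancels ⟩
    ∑[ S₁ ∈ 𝒮 ] [ S₁ ≡ˢ Y ] [ X ≡ˢ cl S₁ ] 1#
      ≈⟨ ∑-δ Y _ ⟩
    [ X ≡ˢ cl Y ] 1#
      ≡⟨ ≡.cong (λ W → [ X ≡ˢ W ] 1#) (cl-fixes-flat flatY) ⟩
    [ X ≡ˢ Y ] 1# ∎
    where
    factor-S₂ : ∀ S₁ → ∑[ S₂ ∈ 𝒮 ] [ S₁ ⊆ᵇ S₂ ] [ X ≡ˢ cl S₁ ] [ S₂ ⊆ᵇ Y ] (sign ∣ S₁ ∣ * sign ∣ S₂ ∣)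
                      ≈ [ X ≡ˢ cl S₁ ] (sign ∣ S₁ ∣ * (∑[ S₂ ∈ 𝒮 ] [ S₁ ⊆ᵇ S₂ ] [ S₂ ⊆ᵇ Y ] sign ∣ S₂ ∣))
    factor-S₂ S₁ = begin
      _ ≈⟨ ∑-cong 𝒮 (λ S₂ → []-comm (S₁ ⊆ᵇ S₂) (X ≡ˢ cl S₁) _) ⟩
      ∑[ S₂ ∈ 𝒮 ] [ X ≡ˢ cl S₁ ] [ S₁ ⊆ᵇ S₂ ] [ S₂ ⊆ᵇ Y ] (sign ∣ S₁ ∣ * sign ∣ S₂ ∣)
        ≈⟨ []-∑ (X ≡ˢ cl S₁) 𝒮 ⟨
      [ X ≡ˢ cl S₁ ] (∑[ S₂ ∈ 𝒮 ] [ S₁ ⊆ᵇ S₂ ] [ S₂ ⊆ᵇ Y ] (sign ∣ S₁ ∣ * sign ∣ S₂ ∣))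
        ≈⟨ [ X ≡ˢ cl S₁ ]-cong (*-distribˡ-∑[][] (sign ∣ S₁ ∣) 𝒮 (S₁ ⊆ᵇ_) (_⊆ᵇ Y)) ⟨
      _ ∎
    sign-cancels : ∀ S₁ → [ X ≡ˢ cl S₁ ] (sign ∣ S₁ ∣ * [ S₁ ≡ˢ Y ] sign ∣ S₁ ∣) ≈ [ S₁ ≡ˢ Y ] [ X ≡ˢ cl S₁ ] 1#
    sign-cancels S₁ = trans ([ X ≡ˢ cl S₁ ]-cong (trans (*-[] _ (S₁ ≡ˢ Y) _) ([ S₁ ≡ˢ Y ]-cong (sign-square ∣ S₁ ∣))))
                            ([]-comm (X ≡ˢ cl S₁) (S₁ ≡ˢ Y) 1#)

  signedSpans-diagonal : ∀ {X} → Flat X → signedSpans X X ≈ 1#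
  signedSpans-diagonal {X} flatX = begin
    signedSpans X X                                  ≈⟨ ∑-flats-δ flatX (signedSpans X) ⟨
    ∑[ Z ∈ flats ] [ Z ≡ˢ X ] signedSpans X Z        ≈⟨ ∑-cong flats antisymmetry ⟩
    ∑[ Z ∈ flats ] [ interval X X Z ] signedSpans X Z ≈⟨ signedSpans-interval {X} flatX ⟩
    [ X ≡ˢ X ] 1#                                    ≡⟨ ≡.cong (λ b → [ b ] 1#) (det (≡ˢ-reflects X X) (ofʸ ≡.refl)) ⟩
    1#                                               ∎
    where
    antisymmetry : ∀ Z → [ Z ≡ˢ X ] signedSpans X Z ≈ [ interval X X Z ] signedSpans X Z
    antisymmetry Z = reflexive (≡.cong (λ b → [ b ] signedSpans X Z) (det (≡ˢ-reflects Z X) (⊆ᵇ-antisym-reflects X Z)))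

  signedSpans-below : ∀ {X Y} → Flat Y → X ⊆ Y → X ≢ Y →
    (∑[ Z ∈ flats ] [ halfOpenInterval X Y Z ] signedSpans X Z) + signedSpans X Y ≈ 0#
  signedSpans-below {X} {Y} flatY X⊆Y X≢Y = begin
    (∑[ Z ∈ flats ] [ halfOpenInterval X Y Z ] signedSpans X Z) + signedSpans X Y
      ≈⟨ +-congˡ (∑-flats-δ flatY (signedSpans X)) ⟨
    (∑[ Z ∈ flats ] [ halfOpenInterval X Y Z ] signedSpans X Z) + (∑[ Z ∈ flats ] [ Z ≡ˢ Y ] signedSpans X Z)
      ≈⟨ ∑-+ flats ⟨
    ∑[ Z ∈ flats ] ([ halfOpenInterval X Y Z ] signedSpans X Z + [ Z ≡ˢ Y ] signedSpans X Z)
      ≈⟨ ∑-cong flats close-interval ⟩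
    ∑[ Z ∈ flats ] [ interval X Y Z ] signedSpans X Z
      ≈⟨ signedSpans-interval {X} flatY ⟩
    [ X ≡ˢ Y ] 1#
      ≡⟨ ≡.cong (λ b → [ b ] 1#) (det (≡ˢ-reflects X Y) (ofⁿ X≢Y)) ⟩
    0# ∎
    where
    Y∈interval : ∀ Z → T (Z ≡ˢ Y) → T (interval X Y Z)
    Y∈interval Z Z≡Y with ≡.refl ← reflects-toWitness (≡ˢ-reflects Z Y) Z≡Y =
      reflects-fromWitness (⊆ᵇ-reflects X Y ×-reflects ⊆ᵇ-reflects Y Y) (X⊆Y , id)
    close-interval : ∀ Z → [ halfOpenInterval X Y Z ] signedSpans X Z + [ Z ≡ˢ Y ] signedSpans X Z
                           ≈ [ interval X Y Z ] signedSpans X Z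
    close-interval Z = begin
      _ ≡⟨ ≡.cong (λ b → [ b ] signedSpans X Z + [ Z ≡ˢ Y ] signedSpans X Z) (∧-assoc (X ⊆ᵇ Z) (Z ⊆ᵇ Y) _) ⟨
      _ ≈⟨ []-split (interval X Y Z) (Z ≡ˢ Y) _ (Y∈interval Z) ⟩
      _ ∎

  signedSpans≈μ' : ∀ k {X Y} → Flat Y → X ⊆ Y → ∣ Y ∣ < k → signedSpans X Y ≈ μ' R k X Y
  signedSpans≈μ' (suc k) {X} {Y} flatY X⊆Y ∣Y∣<1+k with X ≡ˢ Y | ≡ˢ-reflects X Y
  ... | _ | ofʸ ≡.refl = signedSpans-diagonal flatY
  ... | _ | ofⁿ X≢Y with X ⊆ᵇ Y | ⊆ᵇ-reflects X Y
  ...   | _ | ofⁿ X⊈Y = ⊥-elim (X⊈Y X⊆Y)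
  ...   | _ | ofʸ _   = inverseʳ-unique _ _ (begin
    ∑ (filter (λ Z → T? (halfOpenInterval X Y Z)) flats) (μ' R k X) + signedSpans X Y
      ≈⟨ +-congʳ (∑-filter (halfOpenInterval X Y) flats) ⟩
    (∑[ Z ∈ flats ] [ halfOpenInterval X Y Z ] μ' R k X Z) + signedSpans X Y
      ≈⟨ +-congʳ (∑-cong-∈ flats induction) ⟩
    (∑[ Z ∈ flats ] [ halfOpenInterval X Y Z ] signedSpans X Z) + signedSpans X Y
      ≈⟨ signedSpans-below flatY X⊆Y X≢Y ⟩
    0# ∎)
    where
    induction : ∀ {Z} → Z ∈ₗ flats → [ halfOpenInterval X Y Z ] μ' R k X Z ≈ [ halfOpenInterval X Y Z ] signedSpans X Z
    induction {Z} Z∈flats with X ⊆ᵇ Z | ⊆ᵇ-reflects X Z | Z ⊆ᵇ Y | ⊆ᵇ-reflects Z Y | Z ≡ˢ Y | ≡ˢ-reflects Z Y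
    ... | _ | ofⁿ _   | _ | _       | _ | _       = refl
    ... | _ | ofʸ _   | _ | ofⁿ _   | _ | _       = refl
    ... | _ | ofʸ _   | _ | ofʸ _   | _ | ofʸ _   = refl
    ... | _ | ofʸ X⊆Z | _ | ofʸ Z⊆Y | _ | ofⁿ Z≢Y =
      sym (signedSpans≈μ' k (∈flats⇒Flat Z∈flats) X⊆Z (ℕ.<-≤-trans (⊂⇒∣∣< Z⊆Y Z≢Y) (ℕ.≤-pred ∣Y∣<1+k)))

  signedSpans≈μ : ∀ {X Y} → Flat Y → signedSpans X Y ≈ [ X ⊆ᵇ Y ] μ R X Y
  signedSpans≈μ {X} {Y} flatY =
    []-by-cases (⊆ᵇ-reflects X Y) (λ X⊆Y → signedSpans≈μ' (suc n) {X} flatY X⊆Y (s≤s (∣p∣≤n Y))) signedSpans-⊈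

  mobiusPoly-expansion : ∀ s t → mobiusPoly R s t
                                   ≈ ∑[ X ∈ flats ] ∑[ Y ∈ flats ] signedSpans X Y * (pow R s (crk X) * pow R t (crk Y))
  mobiusPoly-expansion s t = ∑-cong flats λ X → ∑-cong-∈ flats λ {Y} Y∈flats →
    trans (sym ([]-* (X ⊆ᵇ Y) _ _)) (*-congʳ (sym (signedSpans≈μ {X} (∈flats⇒Flat Y∈flats))))

  T²-weight : ∀ x S → pow R ((1# - x) - 1#) (crk S) * pow R (0# - 1#) (nullity S) ≈ pow R x (crk S) * sign (rk ⊤ ℕ.+ ∣ S ∣)
  T²-weight x S = begin
    pow R ((1# - x) - 1#) (crk S) * pow R (0# - 1#) (nullity S)
      ≈⟨ *-cong (pow-cong (crk S) (trans (xyx⁻¹≈y 1# (- x)) (-x≈x*-1 x))) (pow-cong (nullity S) (+-identityˡ (- 1#))) ⟩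
    pow R (x * - 1#) (crk S) * sign (nullity S)
      ≈⟨ *-congʳ (pow-distrib-* x (- 1#) (crk S)) ⟩
    (pow R x (crk S) * sign (crk S)) * sign (nullity S)
      ≈⟨ *-assoc _ _ _ ⟩
    pow R x (crk S) * (sign (crk S) * sign (nullity S))
      ≈⟨ *-congˡ (pow-homo-* (- 1#) (crk S) (nullity S)) ⟨
    pow R x (crk S) * sign (crk S ℕ.+ nullity S)
      ≈⟨ *-congˡ (sign-even (crk S ℕ.+ nullity S) (rk S)) ⟨
    pow R x (crk S) * sign ((crk S ℕ.+ nullity S) ℕ.+ (rk S ℕ.+ rk S))
      ≡⟨ ≡.cong (λ k → pow R x (crk S) * sign k) (rank-parity S) ⟩
    pow R x (crk S) * sign (rk ⊤ ℕ.+ ∣ S ∣) ∎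
    where
    -x≈x*-1 : ∀ x → - x ≈ x * - 1#
    -x≈x*-1 x = trans (-‿cong (sym (*-identityʳ x))) (-‿distribʳ-* x 1#)

  crk-expansion : ∀ x S → pow R x (crk S) ≈ ∑[ X ∈ flats ] [ X ≡ˢ cl S ] pow R x (crk X)
  crk-expansion x S = begin
    pow R x (crk S)                               ≡⟨ ≡.cong (pow R x) (crk-cl S) ⟨
    pow R x (crk (cl S))                          ≈⟨ ∑-flats-δ (cl-flat S) (λ X → pow R x (crk X)) ⟨
    ∑[ X ∈ flats ] [ X ≡ˢ cl S ] pow R x (crk X)  ∎

  T²-expansion : ∀ s t → T² R (1# - s) (1# - t) 0# 0#
                           ≈ ∑[ X ∈ flats ] ∑[ Y ∈ flats ] signedSpans X Y * (pow R s (crk X) * pow R t (crk Y))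
  T²-expansion s t = begin
    T² R (1# - s) (1# - t) 0# 0#
      ≈⟨ ∑-cong 𝒮 (λ S₁ → ∑-cong 𝒮 λ S₂ → [ S₁ ⊆ᵇ S₂ ]-cong (weights S₁ S₂)) ⟩
    ∑[ S₁ ∈ 𝒮 ] ∑[ S₂ ∈ 𝒮 ] [ S₁ ⊆ᵇ S₂ ] ((ps S₁ * pt S₂) * (sign ∣ S₁ ∣ * sign ∣ S₂ ∣))
      ≈⟨ ∑-cong 𝒮 (λ S₁ → ∑-cong 𝒮 λ S₂ → group-by-closures S₁ S₂) ⟩
    ∑[ S₁ ∈ 𝒮 ] ∑[ S₂ ∈ 𝒮 ] ∑[ X ∈ flats ] ∑[ Y ∈ flats ] spanTerm X Y S₁ S₂ * (ps X * pt Y)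
      ≈⟨ ∑²-comm 𝒮 𝒮 flats flats ⟩
    ∑[ X ∈ flats ] ∑[ Y ∈ flats ] ∑[ S₁ ∈ 𝒮 ] ∑[ S₂ ∈ 𝒮 ] spanTerm X Y S₁ S₂ * (ps X * pt Y)
      ≈⟨ ∑-cong flats (λ X → ∑-cong flats λ Y →
           sym (trans (*-distribʳ-∑ _ 𝒮) (∑-cong 𝒮 λ S₁ → *-distribʳ-∑ _ 𝒮))) ⟩
    ∑[ X ∈ flats ] ∑[ Y ∈ flats ] signedSpans X Y * (ps X * pt Y) ∎
    where
    ps pt : Subset n → Carrier
    ps S = pow R s (crk S)
    pt S = pow R t (crk S)

    weights : ∀ S₁ S₂ → (pow R ((1# - s) - 1#) (crk S₁) * pow R (0# - 1#) (nullity S₁))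
                        * (pow R ((1# - t) - 1#) (crk S₂) * pow R (0# - 1#) (nullity S₂))
                      ≈ (ps S₁ * pt S₂) * (sign ∣ S₁ ∣ * sign ∣ S₂ ∣)
    weights S₁ S₂ = begin
      _ ≈⟨ *-cong (T²-weight s S₁) (T²-weight t S₂) ⟩
      (ps S₁ * sign (rk ⊤ ℕ.+ ∣ S₁ ∣)) * (pt S₂ * sign (rk ⊤ ℕ.+ ∣ S₂ ∣)) ≈⟨ *-interchange _ _ _ _ ⟩
      (ps S₁ * pt S₂) * (sign (rk ⊤ ℕ.+ ∣ S₁ ∣) * sign (rk ⊤ ℕ.+ ∣ S₂ ∣)) ≈⟨ *-congˡ (sign-shift² (rk ⊤) _ _) ⟩
      (ps S₁ * pt S₂) * (sign ∣ S₁ ∣ * sign ∣ S₂ ∣) ∎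

    group-by-closures : ∀ S₁ S₂ → [ S₁ ⊆ᵇ S₂ ] ((ps S₁ * pt S₂) * (sign ∣ S₁ ∣ * sign ∣ S₂ ∣))
                                 ≈ ∑[ X ∈ flats ] ∑[ Y ∈ flats ] spanTerm X Y S₁ S₂ * (ps X * pt Y)
    group-by-closures S₁ S₂ = begin
      [ S₁ ⊆ᵇ S₂ ] ((ps S₁ * pt S₂) * e)
        ≈⟨ [ S₁ ⊆ᵇ S₂ ]-cong (*-congʳ (trans (*-cong (crk-expansion s S₁) (crk-expansion t S₂)) (∑*∑ flats flats))) ⟩
      [ S₁ ⊆ᵇ S₂ ] ((∑[ X ∈ flats ] ∑[ Y ∈ flats ] [ X ≡ˢ cl S₁ ] ps X * [ Y ≡ˢ cl S₂ ] pt Y) * e)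
        ≈⟨ [ S₁ ⊆ᵇ S₂ ]-cong (trans (*-distribʳ-∑ e flats) (∑-cong flats λ X → *-distribʳ-∑ e flats)) ⟩
      [ S₁ ⊆ᵇ S₂ ] (∑[ X ∈ flats ] ∑[ Y ∈ flats ] ([ X ≡ˢ cl S₁ ] ps X * [ Y ≡ˢ cl S₂ ] pt Y) * e)
        ≈⟨ trans ([]-∑ (S₁ ⊆ᵇ S₂) flats) (∑-cong flats λ X → []-∑ (S₁ ⊆ᵇ S₂) flats) ⟩
      ∑[ X ∈ flats ] ∑[ Y ∈ flats ] [ S₁ ⊆ᵇ S₂ ] (([ X ≡ˢ cl S₁ ] ps X * [ Y ≡ˢ cl S₂ ] pt Y) * e)
        ≈⟨ ∑-cong flats (λ X → ∑-cong flats λ Y → []-gather (S₁ ⊆ᵇ S₂) (X ≡ˢ cl S₁) (Y ≡ˢ cl S₂) _ _ e) ⟩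
      ∑[ X ∈ flats ] ∑[ Y ∈ flats ] spanTerm X Y S₁ S₂ * (ps X * pt Y) ∎
      where
      e : Carrier
      e = sign ∣ S₁ ∣ * sign ∣ S₂ ∣

proposition5p11 : {c ℓ : Level} (R : CommutativeRing c ℓ) {n : ℕ} (M : Matroid n) (s t : CommutativeRing.Carrier R) →
    CommutativeRing._≈_ R
      (MatroidDefs.T² M R (CommutativeRing._-_ R (CommutativeRing.1# R) s) (CommutativeRing._-_ R (CommutativeRing.1# R) t) (CommutativeRing.0# R) (CommutativeRing.0# R))
      (MatroidDefs.mobiusPoly M R s t)
proposition5p11 R M s t = trans (T²-expansion s t) (sym (mobiusPoly-expansion s t))
  where
  open CommutativeRing R using (trans; sym)
  open Möbius R M using (T²-expansion; mobiusPoly-expansion)
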